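{- Let $q$ be an odd prime power, $n\ge1$, and let $V\subsetneq\mathbb{F}_{q^n}$ be a proper $\mathbb{F}_q$-vector subspace. For each $y\in\mathbb{F}_{q^n}$ set $A_y=\{u\in\mathbb{F}_{q^n}: u^2\in y^2+V\}$. Then each $A_y$ is the vertex set of a connected component of $\Gamma(Q_-,V)$, and this component is a clique (hence a maximal clique). In particular, $\Gamma(Q_-,V)$ is disconnected.
   Context: $Q_-(X,Y)=X^2-Y^2$. $\Gamma(Q_-,V)$ is the undirected simple graph with vertex set $\mathbb{F}_{q^n}$ in which distinct $x,y$ are adjacent iff $x^2-y^2\in V$. For $c\in\mathbb{F}_{q^n}$, $c+V=\{c+v:v\in V\}$. -}

module Defs where

open import Level using (0ℓ)
open import Data.Nat using (ℕ; _^_; _≥_)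
open import Data.Nat.Primality using (Prime)
open import Data.Fin using (Fin)
open import Data.Bool using (Bool; true)
open import Data.Product using (Σ; ∃; ∃-syntax; _×_)
open import Relation.Nullary using (¬_)
open import Relation.Binary.PropositionalEquality using (_≡_; _≢_)
open import Algebra.Structures using (IsCommutativeRing)
open import Function.Bundles using (_↔_)
open import Relation.Binary.Construct.Closure.ReflexiveTransitive using (Star)

OddPrimePower : ℕ → Set
OddPrimePower q = ∃[ p ] ∃[ k ] (Prime p × p ≢ 2 × k ≥ 1 × q ≡ p ^ k)

record FiniteField : Set₁ where
  infixl 6 _+_
  infixl 7 _*_
  field
    K     : Set
    _+_   : K → K → K
    _*_   : K → K → K
    -_    : K → K
    0#    : K
    1#    : K
    isCommutativeRing : IsCommutativeRing _≡_ _+_ _*_ -_ 0# 1#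
    0≢1   : 0# ≢ 1#
    inv   : (x : K) → x ≢ 0# → K
    inv-r : (x : K) (x≢0 : x ≢ 0#) → x * inv x x≢0 ≡ 1#
    size  : ℕ
    enum  : K ↔ Fin size

module _ (𝔽 : FiniteField) where
  open FiniteField 𝔽

  -- A subfield of K with exactly q elements (this plays the role of F_q
  -- inside F_{q^n}). Membership is Bool-valued so that the count is exact.
  record Subfield (q : ℕ) : Set where
    field
      inS    : K → Bool
      S-0    : inS 0# ≡ true
      S-1    : inS 1# ≡ true
      S-+    : ∀ x y → inS x ≡ true → inS y ≡ true → inS (x + y) ≡ true
      S-neg  : ∀ x → inS x ≡ true → inS (- x) ≡ true
      S-*    : ∀ x y → inS x ≡ true → inS y ≡ true → inS (x * y) ≡ true
      S-inv  : ∀ x (x≢0 : x ≢ 0#) → inS x ≡ true → inS (inv x x≢0) ≡ true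
      S-card : Σ K (λ x → inS x ≡ true) ↔ Fin q

  record IsSubspace {q : ℕ} (S : Subfield q) (V : K → Set) : Set where
    open Subfield S
    field
      V-0 : V 0#
      V-+ : ∀ x y → V x → V y → V (x + y)
      V-· : ∀ c x → inS c ≡ true → V x → V (c * x)

  Proper : (K → Set) → Set
  Proper V = ∃[ x ] ¬ V x

  Adj : (K → Set) → K → K → Set
  Adj V x y = x ≢ y × V (x * x + - (y * y))

  Connected : (K → Set) → K → K → Set
  Connected V = Star (Adj V)

  A : (K → Set) → K → K → Set
  A V y u = ∃[ v ] (V v × u * u ≡ y * y + v)

{-# OPTIONS --safe #-}
-- Since u² ∈ y² + V just says u² − y² ∈ V, the sets A_y are the classes of the
-- equivalence u ∼ w :⇔ u² − w² ∈ V, and adjacency is ∼ restricted to distinct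
-- vertices; hence each class is a clique and a connected component. For
-- disconnectedness write some x ∉ V as a² − b², so that a ≁ b. Every element of a
-- finite field is such a difference: x = (1 + b)² − b² with 2b = x − 1 when 2 ≠ 0,
-- and x = w² − 0² when 2 = 0, because squaring is then injective, hence surjective.
module Submission where

open import Defs
open import Level using (0ℓ)
open import Data.Nat using (ℕ; suc; _^_; _≥_)
open import Data.Nat.Properties using (n<1+n)
open import Data.Fin using (Fin; punchOut)
open import Data.Fin.Properties using (any?; punchOut-injective; <⇒notInjective)
  renaming (_≟_ to _≟ᶠ_)
open import Data.Product using (_×_; ∃-syntax; _,_)
open import Data.Empty using (⊥-elim)
open import Relation.Nullary using (¬_; yes; no; contradiction)
open import Relation.Nullary.Decidable using (via-injection)
open import Relation.Unary using (Pred)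
open import Relation.Binary.Core using (Rel)
open import Relation.Binary.Definitions using (DecidableEquality; _Respects_)
open import Relation.Binary.Structures using (IsEquivalence)
import Relation.Binary.Construct.On as On
open import Relation.Binary.PropositionalEquality using (_≡_; _≢_; refl; sym; trans; cong; subst; module ≡-Reasoning)
open import Relation.Binary.Construct.Closure.ReflexiveTransitive as Star using (Star; _◅_; fold)
open import Function.Base using (_∘_)
open import Function.Bundles using (_⇔_; mk⇔; _↔_; Inverse; Injection; Equivalence)
open import Function.Properties.Equivalence using () renaming (trans to ⇔-trans; sym to ⇔-sym)
open import Function.Definitions using (Injective)
open import Function.Properties.Inverse using (↔⇒↣; ↔-sym)
open import Algebra.Bundles using (AbelianGroup; CommutativeRing)

module _ {a ℓ} {X : Set a} {_∼_ : Rel X ℓ} where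

  star-offDiagonal⇔ : DecidableEquality X → IsEquivalence _∼_ →
                      ∀ {x y} → Star (λ u v → u ≢ v × u ∼ v) x y ⇔ x ∼ y
  star-offDiagonal⇔ _≟_ isEquivalence {x} {y} =
    mk⇔ (fold _∼_ (λ (_ , u∼v) → ∼-trans u∼v) ∼-refl) edge
    where
    open IsEquivalence isEquivalence renaming (refl to ∼-refl; trans to ∼-trans)
    edge : x ∼ y → Star (λ u v → u ≢ v × u ∼ v) x y
    edge x∼y with x ≟ y
    ... | yes refl = Star.ε
    ... | no x≢y   = (x≢y , x∼y) ◅ Star.ε

Fin-injective⇒surjective : ∀ {n} {f : Fin n → Fin n} → Injective _≡_ _≡_ f →
                           ∀ t → ∃[ i ] f i ≡ t
Fin-injective⇒surjective {suc n} {f} f-injective t with any? (λ i → f i ≟ᶠ t)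
... | yes hit = hit
... | no miss = ⊥-elim (<⇒notInjective (n<1+n n) g-injective)
  where
  t≢f : ∀ i → t ≢ f i
  t≢f i t≡fi = miss (i , sym t≡fi)
  g : Fin (suc n) → Fin n
  g i = punchOut (t≢f i)
  g-injective : Injective _≡_ _≡_ g
  g-injective = f-injective ∘ punchOut-injective (t≢f _) (t≢f _)

module _ {a} {A : Set a} {n} (enumeration : A ↔ Fin n) where
  open Inverse enumeration using (to; from)

  private
    to-injective : Injective _≡_ _≡_ to
    to-injective = Injection.injective (↔⇒↣ enumeration)

    from-injective : Injective _≡_ _≡_ from
    from-injective = Injection.injective (↔⇒↣ (↔-sym enumeration))

  finite-injective⇒surjective : ∀ {f : A → A} → Injective _≡_ _≡_ f → ∀ y → ∃[ x ] f x ≡ y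
  finite-injective⇒surjective {f} f-injective y
    with i , hit ← Fin-injective⇒surjective {f = to ∘ f ∘ from}
                     (from-injective ∘ f-injective ∘ to-injective) (to y)
    = from i , to-injective hit

module _ {a ℓ} (G : AbelianGroup a ℓ) where
  open AbelianGroup G renaming (sym to ≈-sym)
  open import Relation.Binary.Reasoning.Setoid setoid
  open import Algebra.Properties.AbelianGroup G using (\\-leftDividesʳ)

  x-y∙y-z≈x-z : ∀ x y z → (x - y) ∙ (y - z) ≈ x - z
  x-y∙y-z≈x-z x y z = begin
    (x - y) ∙ (y - z)   ≈⟨ assoc x (y ⁻¹) (y - z) ⟩
    x ∙ (y ⁻¹ ∙ (y - z)) ≈⟨ ∙-congˡ (\\-leftDividesʳ y (z ⁻¹)) ⟩
    x - z               ∎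

  module CongruenceModulo {p} (V : Pred Carrier p) (V-resp : V Respects _≈_) (V-ε : V ε)
    (V-∙ : ∀ x y → V x → V y → V (x ∙ y)) (V-⁻¹ : ∀ x → V x → V (x ⁻¹))
    where

    open import Algebra.Properties.AbelianGroup G
      using (⁻¹-anti-homo‿-; //-rightDividesˡ; //-rightDividesʳ)

    _≋_ : Rel Carrier p
    x ≋ y = V (x - y)

    ≋-isEquivalence : IsEquivalence _≋_
    ≋-isEquivalence = record
      { refl  = λ {x} → V-resp (≈-sym (inverseʳ x)) V-ε
      ; sym   = λ {x} {y} x≋y → V-resp (⁻¹-anti-homo‿- x y) (V-⁻¹ _ x≋y)
      ; trans = λ {x} {y} {z} x≋y y≋z → V-resp (x-y∙y-z≈x-z x y z) (V-∙ _ _ x≋y y≋z)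
      }

    x∈y+V⇔x≋y : ∀ {x y} → (∃[ v ] V v × x ≈ y ∙ v) ⇔ x ≋ y
    x∈y+V⇔x≋y {x} {y} = mk⇔
      (λ (v , v∈V , x≈y∙v) → V-resp (v≈x-y v x≈y∙v) v∈V)
      (λ x≋y → x - y , x≋y , ≈-sym (y∙[x-y]≈x))
      where
      v≈x-y : ∀ v → x ≈ y ∙ v → v ≈ x - y
      v≈x-y v x≈y∙v = begin
        v           ≈⟨ //-rightDividesʳ y v ⟨
        v ∙ y - y   ≈⟨ ∙-congʳ (comm v y) ⟩
        y ∙ v - y   ≈⟨ ∙-congʳ x≈y∙v ⟨
        x - y       ∎
      y∙[x-y]≈x : y ∙ (x - y) ≈ x
      y∙[x-y]≈x = begin
        y ∙ (x - y) ≈⟨ comm y (x - y) ⟩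
        (x - y) ∙ y ≈⟨ //-rightDividesˡ y x ⟩
        x           ∎

module _ {c ℓ} (R : CommutativeRing c ℓ) where
  open CommutativeRing R
  open import Relation.Binary.Reasoning.Setoid setoid
  open import Algebra.Properties.Ring ring
    using (x[y-z]≈xy-xz; //-rightDividesˡ; //-rightDividesʳ)

  [x+y][x-y]≈x²-y² : ∀ x y → (x + y) * (x - y) ≈ x * x - y * y
  [x+y][x-y]≈x²-y² x y = begin
    (x + y) * (x - y)                  ≈⟨ distribʳ (x - y) x y ⟩
    x * (x - y) + y * (x - y)          ≈⟨ +-cong (x[y-z]≈xy-xz x x y) (x[y-z]≈xy-xz y x y) ⟩
    (x * x - x * y) + (y * x - y * y)  ≈⟨ +-congˡ (+-congʳ (*-comm y x)) ⟩
    (x * x - x * y) + (x * y - y * y)  ≈⟨ x-y∙y-z≈x-z +-abelianGroup (x * x) (x * y) (y * y) ⟩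
    x * x - y * y                      ∎

  x+x≈x*2 : ∀ x → x + x ≈ x * (1# + 1#)
  x+x≈x*2 x = begin
    x + x            ≈⟨ +-cong (*-identityʳ x) (*-identityʳ x) ⟨
    x * 1# + x * 1#  ≈⟨ distribˡ x 1# 1# ⟨
    x * (1# + 1#)    ∎

  [1+b]²-b²≈x : ∀ {x b} → b + b ≈ x - 1# → (1# + b) * (1# + b) - b * b ≈ x
  [1+b]²-b²≈x {x} {b} b+b≈x-1 = begin
    (1# + b) * (1# + b) - b * b     ≈⟨ [x+y][x-y]≈x²-y² (1# + b) b ⟨
    ((1# + b) + b) * ((1# + b) - b) ≈⟨ *-cong (+-assoc 1# b b) (//-rightDividesʳ b 1#) ⟩
    (1# + (b + b)) * 1#             ≈⟨ *-identityʳ (1# + (b + b)) ⟩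
    1# + (b + b)                    ≈⟨ +-congˡ b+b≈x-1 ⟩
    1# + (x - 1#)                   ≈⟨ +-comm 1# (x - 1#) ⟩
    (x - 1#) + 1#                   ≈⟨ //-rightDividesˡ 1# x ⟩
    x                               ∎

module _ (𝔽 : FiniteField) where
  open FiniteField 𝔽

  commutativeRing : CommutativeRing 0ℓ 0ℓ
  commutativeRing = record { isCommutativeRing = isCommutativeRing }

  open CommutativeRing commutativeRing
    using (_-_; *-assoc; *-comm; *-identityʳ; zeroˡ; zeroʳ; +-identityʳ; -‿inverseʳ;
           +-abelianGroup; *-commutativeSemigroup; ring)
  open import Algebra.Properties.Ring ring
    using (-1*x≈-x; -0#≈0#; +-inverseʳ-unique; x∙y⁻¹≈ε⇒x≈y)
  open import Algebra.Properties.CommutativeSemigroup *-commutativeSemigroup using (interchange)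
  open ≡-Reasoning

  _≟_ : DecidableEquality K
  _≟_ = via-injection (↔⇒↣ enum) _≟ᶠ_

  x*x≡0⇒x≡0 : ∀ {x} → x * x ≡ 0# → x ≡ 0#
  x*x≡0⇒x≡0 {x} x*x≡0 with x ≟ 0#
  ... | yes x≡0 = x≡0
  ... | no x≢0  = contradiction 0≡1 0≢1
    where
    x⁻¹ : K
    x⁻¹ = inv x x≢0
    0≡1 : 0# ≡ 1#
    0≡1 = begin
      0#                    ≡⟨ zeroˡ (x⁻¹ * x⁻¹) ⟨
      0# * (x⁻¹ * x⁻¹)      ≡⟨ cong (_* (x⁻¹ * x⁻¹)) x*x≡0 ⟨
      (x * x) * (x⁻¹ * x⁻¹) ≡⟨ interchange x x x⁻¹ x⁻¹ ⟩
      (x * x⁻¹) * (x * x⁻¹) ≡⟨ cong (λ y → y * y) (inv-r x x≢0) ⟩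
      1# * 1#               ≡⟨ *-identityʳ 1# ⟩
      1#                    ∎

  two : K
  two = 1# + 1#

  module _ (two≡0 : two ≡ 0#) where

    -x≡x : ∀ x → - x ≡ x
    -x≡x x = sym (+-inverseʳ-unique x x (begin
      x + x      ≡⟨ x+x≈x*2 commutativeRing x ⟩
      x * two    ≡⟨ cong (x *_) two≡0 ⟩
      x * 0#     ≡⟨ zeroʳ x ⟩
      0#         ∎))

    square-injective : Injective _≡_ _≡_ (λ x → x * x)
    square-injective {w} {z} w²≡z² = x∙y⁻¹≈ε⇒x≈y w z (x*x≡0⇒x≡0 (begin
      (w - z) * (w - z) ≡⟨ cong (λ t → (w + t) * (w - z)) (-x≡x z) ⟩
      (w + z) * (w - z) ≡⟨ [x+y][x-y]≈x²-y² commutativeRing w z ⟩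
      w * w - z * z     ≡⟨ cong (_- z * z) w²≡z² ⟩
      z * z - z * z     ≡⟨ -‿inverseʳ (z * z) ⟩
      0#                ∎))

    square-surjective : ∀ x → ∃[ w ] w * w ≡ x
    square-surjective = finite-injective⇒surjective enum square-injective

  module _ (two≢0 : two ≢ 0#) where

    half : ∀ x → ∃[ b ] b + b ≡ x
    half x = x * two⁻¹ , (begin
      x * two⁻¹ + x * two⁻¹ ≡⟨ x+x≈x*2 commutativeRing (x * two⁻¹) ⟩
      x * two⁻¹ * two       ≡⟨ *-assoc x two⁻¹ two ⟩
      x * (two⁻¹ * two)     ≡⟨ cong (x *_) (trans (*-comm two⁻¹ two) (inv-r two two≢0)) ⟩
      x * 1#                ≡⟨ *-identityʳ x ⟩
      x                     ∎)
      where
      two⁻¹ : K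
      two⁻¹ = inv two two≢0

  difference-of-squares : ∀ x → ∃[ a ] ∃[ b ] a * a - b * b ≡ x
  difference-of-squares x with two ≟ 0#
  ... | yes two≡0 with w , w²≡x ← square-surjective two≡0 x = w , 0# , (begin
    w * w - 0# * 0# ≡⟨ cong (λ t → w * w - t) (zeroˡ 0#) ⟩
    w * w - 0#      ≡⟨ cong (w * w +_) -0#≈0# ⟩
    w * w + 0#      ≡⟨ +-identityʳ (w * w) ⟩
    w * w           ≡⟨ w²≡x ⟩
    x               ∎)
  ... | no two≢0 with b , b+b≡x-1 ← half two≢0 (x - 1#) = 1# + b , b , [1+b]²-b²≈x commutativeRing b+b≡x-1

  subspace-neg : ∀ {q} {S : Subfield 𝔽 q} {V : K → Set} → IsSubspace 𝔽 S V → ∀ x → V x → V (- x)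
  subspace-neg {S = S} {V} isSubspace x x∈V =
    subst V (-1*x≈-x x) (V-· (- 1#) x (S-neg 1# S-1) x∈V)
    where
    open Subfield S
    open IsSubspace isSubspace

  module SquareClasses (V : K → Set) (V-0 : V 0#) (V-+ : ∀ x y → V x → V y → V (x + y))
    (V-neg : ∀ x → V x → V (- x))
    where

    open CongruenceModulo +-abelianGroup V (subst V) V-0 V-+ V-neg

    _∼_ : Rel K 0ℓ
    u ∼ w = (u * u) ≋ (w * w)

    ∼-isEquivalence : IsEquivalence _∼_
    ∼-isEquivalence = On.isEquivalence (λ x → x * x) ≋-isEquivalence

    open IsEquivalence ∼-isEquivalence using () renaming (sym to ∼-sym)

    A⇔∼ : ∀ {y u} → A 𝔽 V y u ⇔ y ∼ u
    A⇔∼ = ⇔-trans x∈y+V⇔x≋y (mk⇔ ∼-sym ∼-sym)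

    Connected⇔∼ : ∀ {x y} → Connected 𝔽 V x y ⇔ x ∼ y
    Connected⇔∼ = star-offDiagonal⇔ _≟_ ∼-isEquivalence

lemma3p2 : (q n : ℕ) → OddPrimePower q → n ≥ 1 →
    (𝔽 : FiniteField) → FiniteField.size 𝔽 ≡ q ^ n →
    (S : Subfield 𝔽 q) → (V : FiniteField.K 𝔽 → Set) →
    IsSubspace 𝔽 S V → Proper 𝔽 V →
    (∀ y →
      (∀ u → A 𝔽 V y u ⇔ Connected 𝔽 V y u)
      × (∀ u w → A 𝔽 V y u → A 𝔽 V y w → u ≢ w → Adj 𝔽 V u w)
      × (∀ w → ¬ A 𝔽 V y w → ∃[ u ] (A 𝔽 V y u × ¬ Adj 𝔽 V u w)))
    × (∃[ x ] ∃[ y ] ¬ Connected 𝔽 V x y)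
lemma3p2 _ _ _ _ 𝔽 _ S V isSubspace (x , x∉V) =
  (λ y → component y , clique y , maximal y) , disconnected
  where
  open IsSubspace isSubspace using (V-0; V-+)
  open SquareClasses 𝔽 V V-0 V-+ (subspace-neg 𝔽 isSubspace)
  open IsEquivalence ∼-isEquivalence renaming (refl to ∼-refl; sym to ∼-sym; trans to ∼-trans)
  open Equivalence using (to; from)

  component : ∀ y u → A 𝔽 V y u ⇔ Connected 𝔽 V y u
  component y u = ⇔-trans A⇔∼ (⇔-sym Connected⇔∼)

  clique : ∀ y u w → A 𝔽 V y u → A 𝔽 V y w → u ≢ w → Adj 𝔽 V u w
  clique y u w u∈A w∈A u≢w = u≢w , ∼-trans (∼-sym (to A⇔∼ u∈A)) (to A⇔∼ w∈A)

  maximal : ∀ y w → ¬ A 𝔽 V y w → ∃[ u ] (A 𝔽 V y u × ¬ Adj 𝔽 V u w)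
  maximal y w w∉A = y , from A⇔∼ ∼-refl , λ (_ , y∼w) → w∉A (from A⇔∼ y∼w)

  disconnected : ∃[ a ] ∃[ b ] ¬ Connected 𝔽 V a b
  disconnected with a , b , a²-b²≡x ← difference-of-squares 𝔽 x =
    a , b , λ a∼b → x∉V (subst V a²-b²≡x (to Connected⇔∼ a∼b))
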